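{- The minimum rank oracle (Min) is not polynomially reducible to any of the following: the rank sum oracle (Sum), the common independence oracle (CI), the maximum rank oracle (Max), and the combined oracle CI+Max.
   Context: Let $\mathbf{M}_1=(E,\mathcal{I}_1)$, $\mathbf{M}_2=(E,\mathcal{I}_2)$ be loopless matroids on a common finite ground set $E$ with rank functions $r_1,r_2$. For a queried $X\subseteq E$: Sum returns $r_1(X)+r_2(X)$; Min returns $\min\{r_1(X),r_2(X)\}$; Max returns $\max\{r_1(X),r_2(X)\}$; CI returns ``Yes'' if $X\in\mathcal{I}_1\cap\mathcal{I}_2$ and ``No'' otherwise; CI+Max returns both the CI answer and the Max answer for $X$. An oracle $\mathcal{O}_1$ is polynomially reducible to an oracle $\mathcal{O}_2$ if, for every such pair of matroids, the answer of $\mathcal{O}_1$ to any query can be computed using a number of calls to $\mathcal{O}_2$ bounded by a polynomial in $|E|$ (in particular, the answers of $\mathcal{O}_2$ must determine those of $\mathcal{O}_1$). -}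

module Defs where

open import Data.Nat using (ℕ; suc; _*_; _^_; _≤_; _<_; _+_; _⊔_; _⊓_)
open import Data.Bool using (Bool; T; _∧_)
open import Data.Fin using (Fin)
open import Data.Fin.Subset using (Subset; ⁅_⁆; _∈_; _∉_; _⊆_; _∪_; ∣_∣; ⊥)
open import Data.Product using (Σ; ∃; _×_; _,_)
open import Relation.Binary.PropositionalEquality using (_≡_)

record Matroid (n : ℕ) : Set where
  field
    indep    : Subset n → Bool
    indep-∅  : T (indep ⊥)
    indep-⊆  : ∀ {I J} → I ⊆ J → T (indep J) → T (indep I)
    indep-aug : ∀ {I J} → T (indep I) → T (indep J) → ∣ I ∣ < ∣ J ∣ →
                ∃ λ e → e ∈ J × e ∉ I × T (indep (⁅ e ⁆ ∪ I))
    rank     : Subset n → ℕ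
    rank-ub  : ∀ X I → I ⊆ X → T (indep I) → ∣ I ∣ ≤ rank X
    rank-att : ∀ X → ∃ λ I → I ⊆ X × T (indep I) × ∣ I ∣ ≡ rank X

Loopless : ∀ {n} → Matroid n → Set
Loopless M = ∀ e → T (Matroid.indep M ⁅ e ⁆)

record LooplessPair (n : ℕ) : Set where
  field
    M₁ M₂ : Matroid n
    loopless₁ : Loopless M₁
    loopless₂ : Loopless M₂

Oracle : Set → Set
Oracle A = ∀ {n} → LooplessPair n → Subset n → A

module _ where
  open LooplessPair
  open Matroid

  SumO : Oracle ℕ
  SumO P X = rank (M₁ P) X + rank (M₂ P) X

  MinO : Oracle ℕ
  MinO P X = rank (M₁ P) X ⊓ rank (M₂ P) X

  MaxO : Oracle ℕ
  MaxO P X = rank (M₁ P) X ⊔ rank (M₂ P) X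

  CIO : Oracle Bool
  CIO P X = indep (M₁ P) X ∧ indep (M₂ P) X

  CIMaxO : Oracle (Bool × ℕ)
  CIMaxO P X = CIO P X , MaxO P X

-- Adaptive query algorithms (decision trees) over ground set Fin n, asking
-- queries with answers in A and outputting a value in B, making at most d calls.
data QTree (n : ℕ) (A B : Set) : ℕ → Set where
  leaf : ∀ {d} → B → QTree n A B d
  ask  : ∀ {d} → Subset n → (A → QTree n A B d) → QTree n A B (suc d)

run : ∀ {n A B d} → QTree n A B d → (Subset n → A) → B
run (leaf b)  O = b
run (ask X k) O = run (k (O X)) O

PolyReducible : ∀ {A₁ A₂} → Oracle A₁ → Oracle A₂ → Set
PolyReducible {A₁} {A₂} O₁ O₂ =
  Σ ℕ λ c → Σ ℕ λ k → ∀ n (X : Subset n) →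
    Σ (QTree n A₂ A₁ (c * suc n ^ k)) λ alg →
      ∀ (P : LooplessPair n) → run alg (O₂ P) ≡ O₁ P X

-- A reduction is a decision tree whose output depends only on the answers of
-- the oracle it queries.  So it suffices to exhibit two pairs of loopless
-- matroids that no query to that oracle tells apart, but whose minimum ranks
-- of the ground set differ.  On the ground set {a, b, c, d} take the pair
-- (M₁, M₂) where M₁ makes c, d parallel and M₂ makes a, b parallel, so that
-- min(r₁(E), r₂(E)) = 3.  Against it put (N, F) resp. (N, U₃,₄), where N makes
-- both a, b and c, d parallel (rank 2) and F is free: then r₁ + r₂ = r_N + r_F
-- everywhere; and the common independent sets of both pairs are those
-- containing neither {a, b} nor {c, d}, while both maxima equal |X| minus one
-- exactly when X = E.
module Submission where

open import Defs
open import Data.Product using (_×_)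
open import Relation.Nullary using (¬_)

open import Data.Bool using (Bool; true; false; T; not; _∧_)
import Data.Bool.Properties as Bool
open import Data.Empty using (⊥-elim)
open import Data.Fin.Properties using (any?; all?)
open import Data.Fin.Subset using (Subset; ⁅_⁆; _∈_; _∉_; _⊆_; _∪_; ∣_∣; ⊤; ⊥)
open import Data.Fin.Subset.Properties using (_⊆?_; _∈?_; anySubset?; ⊥⊆; ∣⊥∣≡0)
open import Data.Nat using (ℕ; zero; suc; _≤_; _<_; _<?_; _⊔_)
import Data.Nat.Properties as ℕ
open import Data.Product using (∃; _,_)
open import Data.Sum using (_⊎_; inj₁; inj₂)
open import Data.Vec using ([]; _∷_)
open import Relation.Nullary using (Dec; yes; no)
open import Relation.Nullary.Decidable
  using (True; toWitness; decidable-stable; ¬?; T?; _×-dec_; _→-dec_)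
open import Relation.Unary using (Pred; Decidable)
open import Relation.Binary.Definitions using (DecidableEquality)
open import Relation.Binary.PropositionalEquality
  using (_≡_; _≢_; _≗_; refl; sym; trans; cong₂; subst)

private
  variable
    n : ℕ

allSubset? : ∀ {ℓ} {P : Pred (Subset n) ℓ} → Decidable P → Dec (∀ X → P X)
allSubset? P? with anySubset? (λ X → ¬? (P? X))
... | yes (X , ¬PX) = no λ ∀P → ¬PX (∀P X)
... | no ∄¬P        = yes λ X → decidable-stable (P? X) λ ¬PX → ∄¬P (X , ¬PX)

decide-≗ : ∀ {A : Set} (_≟_ : DecidableEquality A) (f g : Subset n → A) →
           True (allSubset? λ X → f X ≟ g X) → f ≗ g
decide-≗ _ _ _ = toWitness

maxOver : ∀ n → (Subset n → ℕ) → ℕ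
maxOver zero    f = f []
maxOver (suc n) f = maxOver n (λ X → f (true ∷ X)) ⊔ maxOver n (λ X → f (false ∷ X))

≤-maxOver : ∀ n (f : Subset n → ℕ) X → f X ≤ maxOver n f
≤-maxOver zero    f []          = ℕ.≤-refl
≤-maxOver (suc n) f (true ∷ X)  = ℕ.≤-trans (≤-maxOver n _ X) (ℕ.m≤m⊔n _ _)
≤-maxOver (suc n) f (false ∷ X) = ℕ.≤-trans (≤-maxOver n _ X) (ℕ.m≤n⊔m _ _)

maxOver-attained : ∀ n (f : Subset n → ℕ) → ∃ λ X → f X ≡ maxOver n f
maxOver-attained zero    f = [] , refl
maxOver-attained (suc n) f
  with maxOver-attained n (λ X → f (true ∷ X)) | maxOver-attained n (λ X → f (false ∷ X))
     | ℕ.⊔-sel (maxOver n (λ X → f (true ∷ X))) (maxOver n (λ X → f (false ∷ X)))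
... | X , fX≡ | _ | inj₁ ⊔≡ = true ∷ X , trans fX≡ (sym ⊔≡)
... | _ | Y , fY≡ | inj₂ ⊔≡ = false ∷ Y , trans fY≡ (sym ⊔≡)

DownwardClosed : (Subset n → Bool) → Set
DownwardClosed ind = ∀ J I → I ⊆ J → T (ind J) → T (ind I)

Augmentable : (Subset n → Bool) → Set
Augmentable ind = ∀ I J → T (ind I) → T (ind J) → ∣ I ∣ < ∣ J ∣ →
                  ∃ λ e → e ∈ J × e ∉ I × T (ind (⁅ e ⁆ ∪ I))

downwardClosed? : (ind : Subset n → Bool) → Dec (DownwardClosed ind)
downwardClosed? ind =
  allSubset? λ J → allSubset? λ I → (I ⊆? J) →-dec (T? (ind J) →-dec T? (ind I))

augmentable? : (ind : Subset n → Bool) → Dec (Augmentable ind)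
augmentable? ind =
  allSubset? λ I → allSubset? λ J → T? (ind I) →-dec (T? (ind J) →-dec (∣ I ∣ <? ∣ J ∣ →-dec
    any? λ e → e ∈? J ×-dec ¬? (e ∈? I) ×-dec T? (ind (⁅ e ⁆ ∪ I))))

module _ (ind : Subset n → Bool) where

  weight : Subset n → Subset n → ℕ
  weight X I with I ⊆? X | ind I
  ... | yes _ | true = ∣ I ∣
  ... | _     | _    = 0

  rankOf : Subset n → ℕ
  rankOf X = maxOver n (weight X)

  weight-indep : ∀ {X I} → I ⊆ X → T (ind I) → weight X I ≡ ∣ I ∣
  weight-indep {X} {I} I⊆X indI with I ⊆? X | ind I
  ... | yes _   | true = refl
  ... | no I⊈X  | _    = ⊥-elim (I⊈X I⊆X)

  weight-cases : ∀ X I → (I ⊆ X × T (ind I) × ∣ I ∣ ≡ weight X I) ⊎ weight X I ≡ 0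
  weight-cases X I with I ⊆? X | ind I
  ... | yes I⊆X | true  = inj₁ (I⊆X , _ , refl)
  ... | yes _   | false = inj₂ refl
  ... | no _    | _     = inj₂ refl

  rankOf-ub : ∀ X I → I ⊆ X → T (ind I) → ∣ I ∣ ≤ rankOf X
  rankOf-ub X I I⊆X indI =
    subst (_≤ rankOf X) (weight-indep I⊆X indI) (≤-maxOver n (weight X) I)

  -- A maximising I of weight 0 means the rank is 0, attained by ∅.
  rankOf-attained : T (ind ⊥) → ∀ X → ∃ λ I → I ⊆ X × T (ind I) × ∣ I ∣ ≡ rankOf X
  rankOf-attained ind∅ X with maxOver-attained n (weight X)
  ... | I , wI≡r with weight-cases X I
  ...   | inj₁ (I⊆X , indI , ∣I∣≡wI) = I , I⊆X , indI , trans ∣I∣≡wI wI≡r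
  ...   | inj₂ wI≡0 = ⊥ , ⊥⊆ , ind∅ , trans (∣⊥∣≡0 n) (trans (sym wI≡0) wI≡r)

  fromIndependent : T (ind ⊥) → True (downwardClosed? ind) → True (augmentable? ind) →
                    Matroid n
  fromIndependent ind∅ closed aug = record
    { indep     = ind
    ; indep-∅   = ind∅
    ; indep-⊆   = λ {I} {J} I⊆J → toWitness closed J I I⊆J
    ; indep-aug = λ {I} {J} → toWitness aug I J
    ; rank      = rankOf
    ; rank-ub   = rankOf-ub
    ; rank-att  = rankOf-attained ind∅
    }

looplessPair : (M₁ M₂ : Matroid n) →
               True (all? λ e → T? (Matroid.indep M₁ ⁅ e ⁆)) →
               True (all? λ e → T? (Matroid.indep M₂ ⁅ e ⁆)) → LooplessPair n
looplessPair M₁ M₂ l₁ l₂ = record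
  { M₁ = M₁ ; M₂ = M₂ ; loopless₁ = toWitness l₁ ; loopless₂ = toWitness l₂ }

run-cong : ∀ {A B d} (t : QTree n A B d) {O O′ : Subset n → A} → O ≗ O′ → run t O ≡ run t O′
run-cong (leaf _)  O≗O′ = refl
run-cong (ask X k) {O′ = O′} O≗O′ rewrite O≗O′ X = run-cong (k (O′ X)) O≗O′

¬PolyReducible-if-indistinguishable :
  ∀ {A₁ A₂} {O₁ : Oracle A₁} {O₂ : Oracle A₂} (P Q : LooplessPair n) (X : Subset n) →
  O₂ P ≗ O₂ Q → O₁ P X ≢ O₁ Q X → ¬ PolyReducible O₁ O₂
¬PolyReducible-if-indistinguishable {n} P Q X O₂P≗O₂Q O₁P≢O₁Q (_ , _ , reduce)
  with reduce n X
... | alg , correct =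
  O₁P≢O₁Q (trans (sym (correct P)) (trans (run-cong alg O₂P≗O₂Q) (correct Q)))

parallel-ab parallel-cd parallel-ab-cd uniform₃ free : Matroid 4
parallel-ab    = fromIndependent (λ { (a ∷ b ∷ c ∷ d ∷ []) → not (a ∧ b) }) _ _ _
parallel-cd    = fromIndependent (λ { (a ∷ b ∷ c ∷ d ∷ []) → not (c ∧ d) }) _ _ _
parallel-ab-cd = fromIndependent (λ { (a ∷ b ∷ c ∷ d ∷ []) → not (a ∧ b) ∧ not (c ∧ d) }) _ _ _
uniform₃       = fromIndependent (λ { (a ∷ b ∷ c ∷ d ∷ []) → not (a ∧ b ∧ c ∧ d) }) _ _ _
free           = fromIndependent (λ _ → true) _ _ _

min3 min2-free min2-uniform : LooplessPair 4
min3         = looplessPair parallel-cd parallel-ab _ _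
min2-free    = looplessPair parallel-ab-cd free _ _
min2-uniform = looplessPair parallel-ab-cd uniform₃ _ _

sum-agrees : SumO min3 ≗ SumO min2-free
sum-agrees = decide-≗ ℕ._≟_ _ _ _

ci-agrees : CIO min3 ≗ CIO min2-uniform
ci-agrees = decide-≗ Bool._≟_ _ _ _

max-agrees : MaxO min3 ≗ MaxO min2-uniform
max-agrees = decide-≗ ℕ._≟_ _ _ _

3≢2 : 3 ≢ 2
3≢2 ()

theorem3p2 : ¬ PolyReducible MinO SumO × ¬ PolyReducible MinO CIO
    × ¬ PolyReducible MinO MaxO × ¬ PolyReducible MinO CIMaxO
theorem3p2 =
    ¬PolyReducible-if-indistinguishable min3 min2-free ⊤ sum-agrees 3≢2
  , ¬PolyReducible-if-indistinguishable min3 min2-uniform ⊤ ci-agrees 3≢2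
  , ¬PolyReducible-if-indistinguishable min3 min2-uniform ⊤ max-agrees 3≢2
  , ¬PolyReducible-if-indistinguishable min3 min2-uniform ⊤
      (λ X → cong₂ _,_ (ci-agrees X) (max-agrees X)) 3≢2
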